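{- Let $T$ be the increasing shifted tableau consisting of a single box with entry $p$, and let $a$ be a letter such that $pa(a+1)a$ is an FPF-involution word. Then $T\stackrel{\mathsf{Sp}}{\leftarrow}a(a+1)a=T\stackrel{\mathsf{Sp}}{\leftarrow}(a+1)a(a+1)$.
   Context: Let $s_i$ be the simple transposition $(i\ i{+}1)$, $\mathfrak S_\infty$ the finitely supported permutations of $\{1,2,\dots\}$, $\Theta=(1\,2)(3\,4)\cdots$, $\mathfrak F_\infty=\{\pi^{ -1}\Theta\pi:\pi\in\mathfrak S_\infty\}$. A word $i_1\cdots i_l$ of positive integers is an FPF-involution word if for some $z\in\mathfrak F_\infty$, $z=s_{i_l}\cdots s_{i_1}\Theta s_{i_1}\cdots s_{i_l}$ and $l$ is minimal among words with this property. For a strict partition $\lambda$, $S(\lambda)=\{(i,j):1\le i\le\ell(\lambda),\ i\le j\le\lambda_i+i-1\}$ (rows, columns, main diagonal $(i,i)$); an increasing shifted tableau is a filling of $S(\lambda)$ by positive integers strictly increasing along rows and down columns. FPF-involution Coxeter–Knuth insertion: to insert a letter $a$ into $T$, insert $a$ into the first row, where inserting $x$ into a row or column $L$ means: let $b$ be the smallest entry of $L$ with $x\le b$; if none, append $x$ at the end of $L$ and stop; otherwise (1) if $x=b$, leave $L$ unchanged and insert $x+1$ into the row below (if $L$ is a row) or the next column to the right (if $L$ is a column); (2) if $L$ is a row, $b$ is its first entry and $x\not\equiv b\pmod2$, leave $L$ unchanged and insert $x+2$ into the next column to the right; (3) otherwise replace $b$ by $x$ and insert $b$ into the row below if $L$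 is a row, or into the next column to the right if $L$ is a column or $b$ was on the main diagonal. $T\stackrel{\mathsf{Sp}}{\leftarrow}u_1u_2\cdots u_k$ denotes the tableau obtained by inserting $u_1,\dots,u_k$ successively. -}

module Defs where

open import Data.Nat using (ℕ; zero; suc; _+_; _*_; _∸_; _≤_; _≡ᵇ_; _≤ᵇ_; _<ᵇ_; _%_)
open import Data.Bool using (Bool; true; false; if_then_else_; not; _∧_)
open import Data.List using (List; []; _∷_; length; _++_; [_]; upTo; mapMaybe; foldl; map)
open import Data.Nat.ListAction using (sum)
open import Data.List.Relation.Unary.All using (All)
open import Data.Maybe using (Maybe; just; nothing)
import Data.Maybe as Maybe
open import Data.Product using (_×_; _,_)
open import Function using (_∘_)
open import Relation.Binary.PropositionalEquality using (_≡_)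

-- Permutations, Θ and FPF-involution words
-- Permutations of the positive integers are modelled as functions ℕ → ℕ
-- (0 is an extra fixed point and plays no role).

s : ℕ → ℕ → ℕ
s i n = if n ≡ᵇ i then suc i else (if n ≡ᵇ suc i then i else n)

Θ : ℕ → ℕ
Θ zero = zero
Θ n = if n % 2 ≡ᵇ 1 then suc n else n ∸ 1

twist : List ℕ → (ℕ → ℕ) → (ℕ → ℕ)
twist [] f = f
twist (i ∷ w) f = twist w (s i ∘ f ∘ s i)

-- z_w = s_{iₗ} ⋯ s_{i₁} Θ s_{i₁} ⋯ s_{iₗ}
fpfZ : List ℕ → ℕ → ℕ
fpfZ w = twist w Θ

PosWord : List ℕ → Set
PosWord w = All (1 ≤_) w

IsFPFInvWord : List ℕ → Set
IsFPFInvWord w =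
  PosWord w ×
  (∀ (w' : List ℕ) → PosWord w' → (∀ n → fpfZ w' n ≡ fpfZ w n) → length w ≤ length w')

-- Shifted tableaux: list of rows; row r (0-indexed) occupies columns
-- r, r+1, …, r + length - 1 (0-indexed), so the first entry of a row is
-- on the main diagonal.

Tableau : Set
Tableau = List (List ℕ)

lookupRow : Tableau → ℕ → List ℕ
lookupRow [] _ = []
lookupRow (row ∷ T) zero = row
lookupRow (row ∷ T) (suc r) = lookupRow T r

setRow : Tableau → ℕ → List ℕ → Tableau
setRow [] zero l = l ∷ []
setRow [] (suc r) l = [] ∷ setRow [] r l
setRow (row ∷ T) zero l = l ∷ T
setRow (row ∷ T) (suc r) l = row ∷ setRow T r l

lookupL : List ℕ → ℕ → Maybe ℕ
lookupL [] _ = nothing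
lookupL (x ∷ xs) zero = just x
lookupL (x ∷ xs) (suc k) = lookupL xs k

replaceAt : ℕ → ℕ → List ℕ → List ℕ
replaceAt _ _ [] = []
replaceAt zero v (x ∷ xs) = v ∷ xs
replaceAt (suc k) v (x ∷ xs) = x ∷ replaceAt k v xs

entryAt : Tableau → ℕ → ℕ → Maybe ℕ
entryAt T i j = if i ≤ᵇ j then lookupL (lookupRow T i) (j ∸ i) else nothing

setEntry : Tableau → ℕ → ℕ → ℕ → Tableau
setEntry T i j v = setRow T i (replaceAt (j ∸ i) v (lookupRow T i))

indexed : ℕ → List ℕ → List (ℕ × ℕ)
indexed k [] = []
indexed k (x ∷ xs) = (k , x) ∷ indexed (suc k) xs

-- cells of row r as (column , entry)
rowCells : Tableau → ℕ → List (ℕ × ℕ)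
rowCells T r = indexed r (lookupRow T r)

-- cells of column j as (row , entry), top to bottom
colCells : Tableau → ℕ → List (ℕ × ℕ)
colCells T j = mapMaybe (λ i → Maybe.map (i ,_) (entryAt T i j)) (upTo (length T))

minGeq : ℕ → List (ℕ × ℕ) → Maybe (ℕ × ℕ)
minGeq x = foldl step nothing
  where
  step : Maybe (ℕ × ℕ) → ℕ × ℕ → Maybe (ℕ × ℕ)
  step acc (k , b) with x ≤ᵇ b | acc
  ... | false | _ = acc
  ... | true | nothing = just (k , b)
  ... | true | just (k' , c) = if b <ᵇ c then just (k , b) else acc

data Line : Set where
  rowL : ℕ → Line
  colL : ℕ → Line

-- insert x into line L of T; the first argument is fuel (see fuel below,
-- which is always sufficient: every step moves to a new row or column).
insLine : ℕ → Line → ℕ → Tableau → Tableau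
insLine zero _ _ T = T
insLine (suc f) (rowL r) x T with minGeq x (rowCells T r)
... | nothing = setRow T r (lookupRow T r ++ [ x ])
... | just (j , b) =
  if x ≡ᵇ b then insLine f (rowL (suc r)) (suc x) T
  else if (j ≡ᵇ r) ∧ not (x % 2 ≡ᵇ b % 2) then insLine f (colL (suc r)) (x + 2) T
  else insLine f (if j ≡ᵇ r then colL (suc j) else rowL (suc r)) b (setEntry T r j x)
insLine (suc f) (colL j) x T with minGeq x (colCells T j)
... | nothing = setRow T (length (colCells T j)) (lookupRow T (length (colCells T j)) ++ [ x ])
... | just (i , b) =
  if x ≡ᵇ b then insLine f (colL (suc j)) (suc x) T
  else insLine f (colL (suc j)) b (setEntry T i j x)

size : Tableau → ℕ
size T = sum (map length T)

fuel : Tableau → ℕ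
fuel T = 2 * size T + 3

insertSp : Tableau → ℕ → Tableau
insertSp T a = insLine (fuel T) (rowL 0) a T

insertWordSp : Tableau → List ℕ → Tableau
insertWordSp = foldl insertSp

singleBox : ℕ → Tableau
singleBox p = (p ∷ []) ∷ []

module Submission where

-- Minimality of the word first pins down p.  Words act on functions by
-- conjugation (twist); word equivalence (≋, same conjugation action) is a
-- congruence containing the Coxeter relations s_i² = 1, the braid relation
-- and the commutation of letters at distance ≥ 2, and an odd letter
-- s_{2k+1} commutes with Θ, so it can be dropped at the front of a word
-- without changing z.  For p = a, p = a + 1 and p ≥ a + 3 these moves
-- produce a strictly shorter word with the same z, contradicting
-- minimality; hence p < a or p = a + 2 (admissible-head).  In each of the
-- two remaining cases both insertions are evaluated one letter at a time,
-- each step's comparisons being decided by the Boolean comparison lemmas,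
-- and both words end in the same tableau.

open import Defs
open import Data.Nat
open import Data.Nat.Properties
open import Data.Nat.DivMod using ([m+n]%n≡m%n; [m+kn]%n≡m%n)
open import Data.Bool using (true; false; T)
open import Data.List using (List; []; _∷_; _++_; length)
open import Data.List.Relation.Unary.All using (_∷_; [])
open import Data.Product using (Σ; _,_)
open import Data.Sum using (_⊎_; inj₁; inj₂)
open import Data.Empty using (⊥; ⊥-elim)
open import Data.Unit using (tt)
open import Function using (_∘_)
open import Relation.Nullary using (¬_; yes; no)
open import Relation.Binary using (tri<; tri≈; tri>)
open import Relation.Binary.PropositionalEquality
open ≡-Reasoning

T⇒≡true : ∀ {b} → T b → b ≡ true
T⇒≡true {true} _ = refl

¬T⇒≡false : ∀ {b} → ¬ T b → b ≡ false
¬T⇒≡false {false} _ = refl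
¬T⇒≡false {true} ¬t = ⊥-elim (¬t tt)

≡ᵇ-refl : ∀ n → (n ≡ᵇ n) ≡ true
≡ᵇ-refl n = T⇒≡true (≡⇒≡ᵇ n n refl)

≡ᵇ-false : ∀ {m n} → m ≢ n → (m ≡ᵇ n) ≡ false
≡ᵇ-false {m} {n} m≢n = ¬T⇒≡false (m≢n ∘ ≡ᵇ⇒≡ m n)

≤ᵇ-true : ∀ {m n} → m ≤ n → (m ≤ᵇ n) ≡ true
≤ᵇ-true m≤n = T⇒≡true (≤⇒≤ᵇ m≤n)

≤ᵇ-false : ∀ {m n} → n < m → (m ≤ᵇ n) ≡ false
≤ᵇ-false {m} {n} n<m = ¬T⇒≡false (λ t → <⇒≱ n<m (≤ᵇ⇒≤ m n t))

<ᵇ-true : ∀ {m n} → m < n → (m <ᵇ n) ≡ true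
<ᵇ-true m<n = T⇒≡true (<⇒<ᵇ m<n)

<ᵇ-false : ∀ {m n} → n ≤ m → (m <ᵇ n) ≡ false
<ᵇ-false {m} {n} n≤m = ¬T⇒≡false (λ t → <⇒≱ (<ᵇ⇒< m n t) n≤m)

s-left : ∀ i → s i i ≡ suc i
s-left i rewrite ≡ᵇ-refl i = refl

s-right : ∀ i → s i (suc i) ≡ i
s-right i rewrite ≡ᵇ-false (1+n≢n {i}) | ≡ᵇ-refl i = refl

s-fix : ∀ {i n} → n ≢ i → n ≢ suc i → s i n ≡ n
s-fix n≢i n≢1+i rewrite ≡ᵇ-false n≢i | ≡ᵇ-false n≢1+i = refl

s-below : ∀ {i n} → n < i → s i n ≡ n
s-below n<i = s-fix (<⇒≢ n<i) (<⇒≢ (m<n⇒m<1+n n<i))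

s-above : ∀ {i n} → suc i < n → s i n ≡ n
s-above 1+i<n = s-fix (>⇒≢ (<-trans (n<1+n _) 1+i<n)) (>⇒≢ 1+i<n)

s-involutive : ∀ i n → s i (s i n) ≡ n
s-involutive i n with n ≟ i | n ≟ suc i
... | yes refl | _ = trans (cong (s i) (s-left i)) (s-right i)
... | no _ | yes refl = trans (cong (s i) (s-right i)) (s-left i)
... | no n≢i | no n≢1+i = trans (cong (s i) (s-fix n≢i n≢1+i)) (s-fix n≢i n≢1+i)

s-braid : ∀ i n → s i (s (suc i) (s i n)) ≡ s (suc i) (s i (s (suc i) n))
s-braid i n with n ≟ i | n ≟ suc i | n ≟ suc (suc i)
... | yes refl | _ | _ = begin
  s i (s (suc i) (s i i))              ≡⟨ cong (s i ∘ s (suc i)) (s-left i) ⟩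
  s i (s (suc i) (suc i))              ≡⟨ cong (s i) (s-left (suc i)) ⟩
  s i (suc (suc i))                    ≡⟨ s-above (n<1+n (suc i)) ⟩
  suc (suc i)                          ≡⟨ s-left (suc i) ⟨
  s (suc i) (suc i)                    ≡⟨ cong (s (suc i)) (s-left i) ⟨
  s (suc i) (s i i)                    ≡⟨ cong (s (suc i) ∘ s i) (s-below (n<1+n i)) ⟨
  s (suc i) (s i (s (suc i) i))        ∎
... | no _ | yes refl | _ = begin
  s i (s (suc i) (s i (suc i)))        ≡⟨ cong (s i ∘ s (suc i)) (s-right i) ⟩
  s i (s (suc i) i)                    ≡⟨ cong (s i) (s-below (n<1+n i)) ⟩
  s i i                                ≡⟨ s-left i ⟩
  suc i                                ≡⟨ s-right (suc i) ⟨
  s (suc i) (suc (suc i))              ≡⟨ cong (s (suc i)) (s-above (n<1+n (suc i))) ⟨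
  s (suc i) (s i (suc (suc i)))        ≡⟨ cong (s (suc i) ∘ s i) (s-left (suc i)) ⟨
  s (suc i) (s i (s (suc i) (suc i)))  ∎
... | no _ | no _ | yes refl = begin
  s i (s (suc i) (s i (suc (suc i))))  ≡⟨ cong (s i ∘ s (suc i)) (s-above (n<1+n (suc i))) ⟩
  s i (s (suc i) (suc (suc i)))        ≡⟨ cong (s i) (s-right (suc i)) ⟩
  s i (suc i)                          ≡⟨ s-right i ⟩
  i                                    ≡⟨ s-below (n<1+n i) ⟨
  s (suc i) i                          ≡⟨ cong (s (suc i)) (s-right i) ⟨
  s (suc i) (s i (suc i))              ≡⟨ cong (s (suc i) ∘ s i) (s-right (suc i)) ⟨
  s (suc i) (s i (s (suc i) (suc (suc i)))) ∎
... | no n≢i | no n≢1+i | no n≢2+i = begin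
  s i (s (suc i) (s i n))              ≡⟨ cong (s i ∘ s (suc i)) (fix-i) ⟩
  s i (s (suc i) n)                    ≡⟨ cong (s i) fix-1+i ⟩
  s i n                                ≡⟨ fix-i ⟩
  n                                    ≡⟨ fix-1+i ⟨
  s (suc i) n                          ≡⟨ cong (s (suc i)) fix-i ⟨
  s (suc i) (s i n)                    ≡⟨ cong (s (suc i) ∘ s i) fix-1+i ⟨
  s (suc i) (s i (s (suc i) n))        ∎
  where
  fix-i : s i n ≡ n
  fix-i = s-fix n≢i n≢1+i
  fix-1+i : s (suc i) n ≡ n
  fix-1+i = s-fix n≢1+i n≢2+i

s-commute : ∀ {i j} → suc i < j → ∀ n → s i (s j n) ≡ s j (s i n)
s-commute {i} {j} 1+i<j n with n ≟ i | n ≟ suc i | n ≟ j | n ≟ suc j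
... | yes refl | _ | _ | _ = begin
  s i (s j i)        ≡⟨ cong (s i) (s-below (<-trans (n<1+n i) 1+i<j)) ⟩
  s i i              ≡⟨ s-left i ⟩
  suc i              ≡⟨ s-below 1+i<j ⟨
  s j (suc i)        ≡⟨ cong (s j) (s-left i) ⟨
  s j (s i i)        ∎
... | no _ | yes refl | _ | _ = begin
  s i (s j (suc i))  ≡⟨ cong (s i) (s-below 1+i<j) ⟩
  s i (suc i)        ≡⟨ s-right i ⟩
  i                  ≡⟨ s-below (<-trans (n<1+n i) 1+i<j) ⟨
  s j i              ≡⟨ cong (s j) (s-right i) ⟨
  s j (s i (suc i))  ∎
... | no _ | no _ | yes refl | _ = begin
  s i (s j j)        ≡⟨ cong (s i) (s-left j) ⟩
  s i (suc j)        ≡⟨ s-above (m<n⇒m<1+n 1+i<j) ⟩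
  suc j              ≡⟨ s-left j ⟨
  s j j              ≡⟨ cong (s j) (s-above 1+i<j) ⟨
  s j (s i j)        ∎
... | no _ | no _ | no _ | yes refl = begin
  s i (s j (suc j))  ≡⟨ cong (s i) (s-right j) ⟩
  s i j              ≡⟨ s-above 1+i<j ⟩
  j                  ≡⟨ s-right j ⟨
  s j (suc j)        ≡⟨ cong (s j) (s-above (m<n⇒m<1+n 1+i<j)) ⟨
  s j (s i (suc j))  ∎
... | no n≢i | no n≢1+i | no n≢j | no n≢1+j = begin
  s i (s j n)        ≡⟨ cong (s i) fix-j ⟩
  s i n              ≡⟨ fix-i ⟩
  n                  ≡⟨ fix-j ⟨
  s j n              ≡⟨ cong (s j) fix-i ⟨
  s j (s i n)        ∎
  where
  fix-i : s i n ≡ n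
  fix-i = s-fix n≢i n≢1+i
  fix-j : s j n ≡ n
  fix-j = s-fix n≢j n≢1+j

-- Θ = (1 2)(3 4)⋯ pairs each odd number q with q + 1, so it commutes with
-- the odd transpositions s_q.

Odd : ℕ → Set
Odd n = Σ ℕ λ k → n ≡ suc (k * 2)

Even : ℕ → Set
Even n = Σ ℕ λ k → n ≡ k * 2

even-or-odd : ∀ n → Even n ⊎ Odd n
even-or-odd zero = inj₁ (0 , refl)
even-or-odd (suc n) with even-or-odd n
... | inj₁ (k , refl) = inj₂ (k , refl)
... | inj₂ (k , refl) = inj₁ (suc k , refl)

Θ-odd : ∀ k → Θ (suc (k * 2)) ≡ suc (suc (k * 2))
Θ-odd k rewrite T⇒≡true (≡⇒≡ᵇ _ 1 ([m+kn]%n≡m%n 1 k 2)) = refl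

Θ-even : ∀ k → Θ (suc (suc (k * 2))) ≡ suc (k * 2)
Θ-even k rewrite ≡ᵇ-false (λ (e : suc (suc (k * 2)) % 2 ≡ 1) →
                   0≢1+n (trans (sym ([m+kn]%n≡m%n 0 (suc k) 2)) e)) = refl

Θ-involutive : ∀ n → Θ (Θ n) ≡ n
Θ-involutive n with even-or-odd n
... | inj₁ (zero , refl) = refl
... | inj₁ (suc k , refl) = trans (cong Θ (Θ-even k)) (Θ-odd k)
... | inj₂ (k , refl) = trans (cong Θ (Θ-odd k)) (Θ-even k)

Θ-odd-conj : ∀ {q} → Odd q → ∀ n → s q (Θ (s q n)) ≡ Θ n
Θ-odd-conj {q} (k , refl) n with n ≟ q | n ≟ suc q
... | yes refl | _ = begin
  s q (Θ (s q q))  ≡⟨ cong (s q ∘ Θ) (s-left q) ⟩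
  s q (Θ (suc q))  ≡⟨ cong (s q) (Θ-even k) ⟩
  s q q            ≡⟨ s-left q ⟩
  suc q            ≡⟨ Θ-odd k ⟨
  Θ q              ∎
... | no _ | yes refl = begin
  s q (Θ (s q (suc q)))  ≡⟨ cong (s q ∘ Θ) (s-right q) ⟩
  s q (Θ q)              ≡⟨ cong (s q) (Θ-odd k) ⟩
  s q (suc q)            ≡⟨ s-right q ⟩
  q                      ≡⟨ Θ-even k ⟨
  Θ (suc q)              ∎
... | no n≢q | no n≢1+q = begin
  s q (Θ (s q n))  ≡⟨ cong (s q ∘ Θ) (s-fix n≢q n≢1+q) ⟩
  s q (Θ n)        ≡⟨ s-fix Θn≢q Θn≢1+q ⟩
  Θ n              ∎
  where
  -- Θ is an involution exchanging q and q + 1, so Θ n avoids both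
  Θn≢q : Θ n ≢ q
  Θn≢q e = n≢1+q (trans (sym (Θ-involutive n)) (trans (cong Θ e) (Θ-odd k)))
  Θn≢1+q : Θ n ≢ suc q
  Θn≢1+q e = n≢q (trans (sym (Θ-involutive n)) (trans (cong Θ e) (Θ-even k)))

twist-cong : ∀ w {f g : ℕ → ℕ} → f ≗ g → twist w f ≗ twist w g
twist-cong [] f≗g = f≗g
twist-cong (i ∷ w) f≗g = twist-cong w (λ n → cong (s i) (f≗g (s i n)))

twist-++ : ∀ u v (f : ℕ → ℕ) → twist (u ++ v) f ≡ twist v (twist u f)
twist-++ [] v f = refl
twist-++ (i ∷ u) v f = twist-++ u v (s i ∘ f ∘ s i)

-- Two words are equivalent when they conjugate every function alike,
-- i.e. when they represent the same permutation.
infix 4 _≋_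
record _≋_ (u v : List ℕ) : Set where
  constructor conj-equiv
  field conjugates : ∀ f → twist u f ≗ twist v f
open _≋_

≋⇒fpfZ : ∀ {u v} → u ≋ v → fpfZ u ≗ fpfZ v
≋⇒fpfZ u≋v = conjugates u≋v Θ

≋-refl : ∀ {u} → u ≋ u
≋-refl = conj-equiv λ f n → refl

≋-sym : ∀ {u v} → u ≋ v → v ≋ u
≋-sym u≋v = conj-equiv λ f n → sym (conjugates u≋v f n)

≋-trans : ∀ {u v w} → u ≋ v → v ≋ w → u ≋ w
≋-trans u≋v v≋w = conj-equiv λ f n → trans (conjugates u≋v f n) (conjugates v≋w f n)

≋-++ : ∀ {u v u′ v′} → u ≋ v → u′ ≋ v′ → u ++ u′ ≋ v ++ v′
≋-++ {u} {v} {u′} {v′} u≋v u′≋v′ = conj-equiv λ f n → begin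
  twist (u ++ u′) f n       ≡⟨ cong-app (twist-++ u u′ f) n ⟩
  twist u′ (twist u f) n    ≡⟨ twist-cong u′ (conjugates u≋v f) n ⟩
  twist u′ (twist v f) n    ≡⟨ conjugates u′≋v′ (twist v f) n ⟩
  twist v′ (twist v f) n    ≡⟨ cong-app (twist-++ v v′ f) n ⟨
  twist (v ++ v′) f n       ∎

≋-prefix : ∀ u {v w} → v ≋ w → u ++ v ≋ u ++ w
≋-prefix u = ≋-++ (≋-refl {u})

≋-suffix : ∀ {u v} w → u ≋ v → u ++ w ≋ v ++ w
≋-suffix w u≋v = ≋-++ u≋v (≋-refl {w})

≋-cancel : ∀ i → i ∷ i ∷ [] ≋ []
≋-cancel i = conj-equiv λ f n →
  trans (cong (s i ∘ s i ∘ f) (s-involutive i n)) (s-involutive i (f n))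

≋-braid : ∀ i → i ∷ suc i ∷ i ∷ [] ≋ suc i ∷ i ∷ suc i ∷ []
≋-braid i = conj-equiv λ f n →
  trans (cong (s i ∘ s (suc i) ∘ s i ∘ f) (s-braid i n))
        (s-braid i (f (s (suc i) (s i (s (suc i) n)))))

≋-commute : ∀ {i j} → suc i < j → i ∷ j ∷ [] ≋ j ∷ i ∷ []
≋-commute {i} {j} 1+i<j = conj-equiv λ f n →
  trans (cong (s j ∘ s i ∘ f) (s-commute 1+i<j n))
        (sym (s-commute 1+i<j (f (s j (s i n)))))

drop-odd-letter : ∀ {q} → Odd q → ∀ w → fpfZ (q ∷ w) ≗ fpfZ w
drop-odd-letter q-odd w = twist-cong w (Θ-odd-conj q-odd)

drop-odd-after : ∀ {w q u} → w ≋ q ∷ u → Odd q → fpfZ w ≗ fpfZ u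
drop-odd-after {u = u} w≋qu q-odd n =
  trans (≋⇒fpfZ w≋qu n) (drop-odd-letter q-odd u n)

not-minimal : ∀ {w} u → IsFPFInvWord w → PosWord u
  → fpfZ w ≗ fpfZ u → length u < length w → ⊥
not-minimal u (_ , minimal) u-pos w≗u shorter =
  <⇒≱ shorter (minimal u u-pos (λ n → sym (w≗u n)))

repeated-head : ∀ a → a ∷ a ∷ suc a ∷ a ∷ [] ≋ suc a ∷ a ∷ []
repeated-head a = ≋-suffix (suc a ∷ a ∷ []) (≋-cancel a)

-- p = a + 1: a braid move creates two adjacent letters a, which cancel
braided-head : ∀ a → suc a ∷ a ∷ suc a ∷ a ∷ [] ≋ a ∷ suc a ∷ []
braided-head a = ≋-trans (≋-suffix (a ∷ []) (≋-sym (≋-braid a)))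
                         (≋-prefix (a ∷ suc a ∷ []) (≋-cancel a))

-- p ≥ a + 3: s_p commutes with s_a and s_{a+1}, so p moves to the end
far-head : ∀ {p a} → suc (suc (suc a)) ≤ p
  → p ∷ a ∷ suc a ∷ a ∷ [] ≋ a ∷ suc a ∷ a ∷ p ∷ []
far-head {p} {a} 3+a≤p =
  ≋-trans (≋-suffix (suc a ∷ a ∷ []) (≋-sym (≋-commute 1+a<p)))
 (≋-trans (≋-prefix (a ∷ []) (≋-suffix (a ∷ []) (≋-sym (≋-commute 3+a≤p))))
          (≋-prefix (a ∷ suc a ∷ []) (≋-sym (≋-commute 1+a<p))))
  where
  1+a<p : suc a < p
  1+a<p = <-trans (n<1+n (suc a)) 3+a≤p

-- ... and then, after a braid move if a is even, an odd letter stands at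
-- the front of a (a+1) a p and can be dropped.
far-head-not-minimal : ∀ {p a} → suc (suc (suc a)) ≤ p
  → ¬ IsFPFInvWord (p ∷ a ∷ suc a ∷ a ∷ [])
far-head-not-minimal {p} {a} 3+a≤p fpf@((pos-p ∷ pos-a ∷ pos-1+a ∷ _) , _)
  with even-or-odd a
... | inj₂ a-odd = not-minimal (suc a ∷ a ∷ p ∷ []) fpf
  (pos-1+a ∷ pos-a ∷ pos-p ∷ [])
  (drop-odd-after (far-head 3+a≤p) a-odd) ≤-refl
... | inj₁ (k , a≡2k) = not-minimal (a ∷ suc a ∷ p ∷ []) fpf
  (pos-a ∷ pos-1+a ∷ pos-p ∷ [])
  (drop-odd-after (≋-trans (far-head 3+a≤p) (≋-suffix (p ∷ []) (≋-braid a)))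
                  (k , cong suc a≡2k)) ≤-refl

admissible-head : ∀ p a → IsFPFInvWord (p ∷ a ∷ suc a ∷ a ∷ [])
  → p < a ⊎ p ≡ suc (suc a)
admissible-head p a fpf@((pos-p ∷ pos-a ∷ pos-1+a ∷ _) , _) with <-cmp p a
... | tri< p<a _ _ = inj₁ p<a
... | tri≈ _ refl _ = ⊥-elim (not-minimal (suc a ∷ a ∷ []) fpf
        (pos-1+a ∷ pos-a ∷ []) (≋⇒fpfZ (repeated-head a)) (n≤1+n 3))
... | tri> _ _ a<p with p ≟ suc a | p ≟ suc (suc a)
...   | yes refl | _ = ⊥-elim (not-minimal (a ∷ suc a ∷ []) fpf
          (pos-a ∷ pos-1+a ∷ []) (≋⇒fpfZ (braided-head a)) (n≤1+n 3))
...   | no _ | yes p≡2+a = inj₂ p≡2+a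
...   | no p≢1+a | no p≢2+a = ⊥-elim (far-head-not-minimal
          (≤∧≢⇒< (≤∧≢⇒< a<p (≢-sym p≢1+a)) (≢-sym p≢2+a)) fpf)

module HeadBelow (p a : ℕ) (p<a : p < a) where

  common : Tableau
  common = (p ∷ a ∷ suc a ∷ []) ∷ (suc a ∷ []) ∷ []

  append-above-p : ∀ {x} → p < x → insertSp ((p ∷ []) ∷ []) x ≡ (p ∷ x ∷ []) ∷ []
  append-above-p p<x rewrite ≤ᵇ-false p<x = refl

  append-1+a : ∀ {rows} → insertSp ((p ∷ a ∷ []) ∷ rows) (suc a)
                        ≡ (p ∷ a ∷ suc a ∷ []) ∷ rows
  append-1+a rewrite <ᵇ-false (<⇒≤ p<a) | <ᵇ-false (≤-refl {a}) = refl

  -- a meets the entry a of the first row, so a + 1 moves to the second row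
  repeat-a : insertSp ((p ∷ a ∷ suc a ∷ []) ∷ []) a ≡ common
  repeat-a rewrite ≤ᵇ-false p<a | ≤ᵇ-true (≤-refl {a}) | ≤ᵇ-true (n≤1+n a)
                 | <ᵇ-false (n≤1+n a) | ≡ᵇ-refl a = refl

  bump-1+a : insertSp ((p ∷ suc a ∷ []) ∷ []) a ≡ (p ∷ a ∷ []) ∷ (suc a ∷ []) ∷ []
  bump-1+a rewrite ≤ᵇ-false p<a | ≤ᵇ-true (n≤1+n a) | ≡ᵇ-false (<⇒≢ (n<1+n a)) = refl

  -- p  →  p a  →  p a (a+1)  →  p a (a+1) / (a+1)
  insert-a-1+a-a : insertWordSp (singleBox p) (a ∷ suc a ∷ a ∷ []) ≡ common
  insert-a-1+a-a rewrite append-above-p p<a | append-1+a {[]} | repeat-a = refl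

  -- p  →  p (a+1)  →  p a / (a+1)  →  p a (a+1) / (a+1)
  insert-1+a-a-1+a : insertWordSp (singleBox p) (suc a ∷ a ∷ suc a ∷ []) ≡ common
  insert-1+a-a-1+a rewrite append-above-p (m<n⇒m<1+n p<a) | bump-1+a
                         | append-1+a {(suc a ∷ []) ∷ []} = refl

%2-suc-suc : ∀ n → suc (suc n) % 2 ≡ n % 2
%2-suc-suc n = trans (cong (_% 2) (+-comm 2 n)) ([m+n]%n≡m%n n 2)

%2-suc : ∀ n → suc n % 2 ≢ n % 2
%2-suc zero ()
%2-suc (suc zero) ()
%2-suc (suc (suc n)) e =
  %2-suc n (trans (sym (%2-suc-suc (suc n))) (trans e (%2-suc-suc n)))

-- Here the first entry of a row is compared by parity: a letter of the
-- same parity as the diagonal entry bumps it into the next column, one of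
-- the other parity sends its successor by two into the next column.
module HeadTwoAbove (a : ℕ) where

  common : Tableau
  common = (a ∷ suc a ∷ suc (suc (suc a)) ∷ []) ∷ (suc (suc a) ∷ []) ∷ []

  a<2+a : a < suc (suc a)
  a<2+a = m<n⇒m<1+n (n<1+n a)

  -- a displaces the diagonal a + 2 (same parity), which moves to column 2
  bump-diagonal : insertSp ((suc (suc a) ∷ []) ∷ []) a ≡ (a ∷ suc (suc a) ∷ []) ∷ []
  bump-diagonal rewrite ≤ᵇ-true (<⇒≤ a<2+a) | ≡ᵇ-false (<⇒≢ a<2+a)
                      | %2-suc-suc a | ≡ᵇ-refl (a % 2) = refl

  bump-into-row-2 : insertSp ((a ∷ suc (suc a) ∷ []) ∷ []) (suc a)
                  ≡ (a ∷ suc a ∷ []) ∷ (suc (suc a) ∷ []) ∷ []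
  bump-into-row-2 rewrite <ᵇ-false (≤-refl {a}) | <ᵇ-true a<2+a
                        | ≡ᵇ-false (<⇒≢ (n<1+n a)) = refl

  -- a meets a in row 1, so a + 1 is inserted into row 2; there it meets the
  -- diagonal a + 2 of the other parity, and a + 3 goes to column 3
  repeat-a : insertSp ((a ∷ suc a ∷ []) ∷ (suc (suc a) ∷ []) ∷ []) a ≡ common
  repeat-a rewrite ≤ᵇ-true (≤-refl {a}) | ≤ᵇ-true (n≤1+n a) | <ᵇ-false (n≤1+n a)
                 | ≡ᵇ-refl a | <ᵇ-true a<2+a | ≡ᵇ-false (<⇒≢ (n<1+n a))
                 | %2-suc-suc a | ≡ᵇ-false (%2-suc a) | +-comm a 2 = refl

  -- a + 1 meets the diagonal a + 2 of the other parity: a + 3 goes to column 2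
  skip-diagonal : insertSp ((suc (suc a) ∷ []) ∷ []) (suc a)
                ≡ (suc (suc a) ∷ suc (suc (suc a)) ∷ []) ∷ []
  skip-diagonal rewrite <ᵇ-true a<2+a | ≡ᵇ-false (<⇒≢ (n<1+n a))
                      | %2-suc-suc a | ≡ᵇ-false (%2-suc a) | +-comm a 2 = refl

  -- a displaces the diagonal a + 2, which displaces a + 3 in column 2,
  -- which lands in column 3
  bump-twice : insertSp ((suc (suc a) ∷ suc (suc (suc a)) ∷ []) ∷ []) a
             ≡ (a ∷ suc (suc a) ∷ suc (suc (suc a)) ∷ []) ∷ []
  bump-twice rewrite ≤ᵇ-true (<⇒≤ a<2+a) | ≤ᵇ-true (<⇒≤ (m<n⇒m<1+n a<2+a))
                   | <ᵇ-false (n≤1+n a) | ≡ᵇ-false (<⇒≢ a<2+a)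
                   | %2-suc-suc a | ≡ᵇ-refl (a % 2)
                   | <ᵇ-true a<2+a | ≡ᵇ-false (<⇒≢ (n<1+n a)) = refl

  bump-off-diagonal : insertSp ((a ∷ suc (suc a) ∷ suc (suc (suc a)) ∷ []) ∷ []) (suc a)
                    ≡ common
  bump-off-diagonal rewrite <ᵇ-false (≤-refl {a}) | <ᵇ-true a<2+a
                          | <ᵇ-true (m<n⇒m<1+n a<2+a) | <ᵇ-false (n≤1+n a)
                          | ≡ᵇ-false (<⇒≢ (n<1+n a)) = refl

  -- a+2  →  a (a+2)  →  a (a+1) / (a+2)  →  a (a+1) (a+3) / (a+2)
  insert-a-1+a-a : insertWordSp (singleBox (suc (suc a))) (a ∷ suc a ∷ a ∷ []) ≡ common
  insert-a-1+a-a rewrite bump-diagonal | bump-into-row-2 | repeat-a = refl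

  -- a+2  →  (a+2) (a+3)  →  a (a+2) (a+3)  →  a (a+1) (a+3) / (a+2)
  insert-1+a-a-1+a : insertWordSp (singleBox (suc (suc a))) (suc a ∷ a ∷ suc a ∷ []) ≡ common
  insert-1+a-a-1+a rewrite skip-diagonal | bump-twice | bump-off-diagonal = refl

lemmaA5 : (p a : ℕ) → IsFPFInvWord (p ∷ a ∷ suc a ∷ a ∷ [])
    → insertWordSp (singleBox p) (a ∷ suc a ∷ a ∷ [])
    ≡ insertWordSp (singleBox p) (suc a ∷ a ∷ suc a ∷ [])
lemmaA5 p a fpf with admissible-head p a fpf
... | inj₁ p<a = trans insert-a-1+a-a (sym insert-1+a-a-1+a)
  where open HeadBelow p a p<a
... | inj₂ refl = trans insert-a-1+a-a (sym insert-1+a-a-1+a)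
  where open HeadTwoAbove a
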